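{- Let $G$ be a simple graph and let $\Pi=\{C_1,\ldots,C_k\}$ be an equitable partition of $V(G)$ with divisor matrix $B$. Let $\lambda$ be an eigenvalue of $B$ (equivalently, of $B^{\mathrm{T}}$). Then the following are equivalent: (i) $B$ has an eigenvector associated with $\lambda$ which is not orthogonal to the vector $(|C_1|,\ldots,|C_k|)^{\mathrm{T}}$; (ii) $B^{\mathrm{T}}$ has an eigenvector associated with $\lambda$ which is not orthogonal to the all-ones vector $e_k\in\mathbb{R}^k$.
   Context: A partition $\Pi=\{C_1,\ldots,C_k\}$ of the vertex set of a graph $G$ (into nonempty cells) is equitable if for all $i,j\in\{1,\ldots,k\}$ there is a constant $b_{ij}$ such that every vertex in $C_i$ has exactly $b_{ij}$ neighbors in $C_j$. The $k\times k$ matrix $B=(b_{ij})$ is called the divisor matrix of $\Pi$. -}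

module Defs where

open import Level using (Level; _⊔_) renaming (suc to lsuc)
open import Data.Nat using (ℕ; zero; suc)
import Data.Nat as ℕ
open import Data.Fin using (Fin; zero; suc; _≟_)
open import Data.Bool using (Bool; true; false; _∧_; if_then_else_)
open import Data.Product using (Σ; ∃; _×_; _,_)
open import Relation.Nullary using (¬_)
open import Relation.Nullary.Decidable using (⌊_⌋)
open import Relation.Binary.PropositionalEquality using (_≡_)
open import Relation.Binary.Structures using (IsTotalOrder)
open import Algebra.Bundles using (CommutativeRing)
open import Function using (Surjective)

record SimpleGraph (n : ℕ) : Set where
  field
    adj        : Fin n → Fin n → Bool
    adj-sym    : ∀ u v → adj u v ≡ adj v u
    adj-irrefl : ∀ v → adj v v ≡ false

countFin : (n : ℕ) → (Fin n → Bool) → ℕ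
countFin zero    p = zero
countFin (suc n) p = (if p zero then 1 else 0) ℕ.+ countFin n (λ i → p (suc i))

-- Partitions of V(G) = Fin n into k nonempty cells C_0,…,C_{k-1}:
-- a surjective map cell : Fin n → Fin k, with C_i = cell ⁻¹ {i}.

IsPartition : (n k : ℕ) → (Fin n → Fin k) → Set
IsPartition n k cell = Surjective _≡_ _≡_ cell

cellSize : {n k : ℕ} → (Fin n → Fin k) → Fin k → ℕ
cellSize {n} cell i = countFin n (λ v → ⌊ cell v ≟ i ⌋)

neighboursIn : {n k : ℕ} → SimpleGraph n → (Fin n → Fin k) → Fin n → Fin k → ℕ
neighboursIn {n} G cell v j =
  countFin n (λ w → SimpleGraph.adj G v w ∧ ⌊ cell w ≟ j ⌋)

IsEquitableWithDivisor : {n k : ℕ} → SimpleGraph n → (Fin n → Fin k) →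
                         (Fin k → Fin k → ℕ) → Set
IsEquitableWithDivisor G cell B =
  ∀ v j → neighboursIn G cell v j ≡ B (cell v) j

-- The real numbers, axiomatised as a Dedekind-complete ordered field
-- (unique up to isomorphism, so quantifying over all of them is the
-- same as speaking about ℝ).

record RealField (c ℓ : Level) : Set (lsuc (c ⊔ ℓ)) where
  field
    commutativeRing : CommutativeRing c ℓ
  open CommutativeRing commutativeRing public
  field
    nontrivial   : ¬ (0# ≈ 1#)
    inverse      : ∀ x → ¬ (x ≈ 0#) → Σ Carrier (λ y → (x * y) ≈ 1#)
    _≤_          : Carrier → Carrier → Set ℓ
    isTotalOrder : IsTotalOrder _≈_ _≤_
    +-mono-≤     : ∀ {x y} z → x ≤ y → (x + z) ≤ (y + z)
    *-nonneg     : ∀ {x y} → 0# ≤ x → 0# ≤ y → 0# ≤ (x * y)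
    complete     : (S : Carrier → Set ℓ) → ∃ S →
                   ∃ (λ b → ∀ x → S x → x ≤ b) →
                   ∃ (λ s → (∀ x → S x → x ≤ s) ×
                            (∀ b → (∀ x → S x → x ≤ b) → s ≤ b))

module _ {c ℓ : Level} (R : RealField c ℓ) where
  open RealField R using (Carrier; _≈_; _+_; _*_; 0#; 1#)

  ι : ℕ → Carrier
  ι zero    = 0#
  ι (suc n) = 1# + ι n

  Σℝ : (k : ℕ) → (Fin k → Carrier) → Carrier
  Σℝ zero    f = 0#
  Σℝ (suc k) f = f zero + Σℝ k (λ i → f (suc i))

  dot : {k : ℕ} → (Fin k → Carrier) → (Fin k → Carrier) → Carrier
  dot {k} x y = Σℝ k (λ i → x i * y i)

  matVec : {k : ℕ} → (Fin k → Fin k → ℕ) → (Fin k → Carrier) → Fin k → Carrier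
  matVec {k} M x i = Σℝ k (λ j → ι (M i j) * x j)

  transpose : {k : ℕ} → (Fin k → Fin k → ℕ) → Fin k → Fin k → ℕ
  transpose M i j = M j i

  NonzeroVec : {k : ℕ} → (Fin k → Carrier) → Set ℓ
  NonzeroVec x = ¬ (∀ i → x i ≈ 0#)

  IsEigenvector : {k : ℕ} → (Fin k → Fin k → ℕ) → Carrier → (Fin k → Carrier) → Set ℓ
  IsEigenvector M λ' x = NonzeroVec x × (∀ i → matVec M x i ≈ (λ' * x i))

  IsEigenvalue : {k : ℕ} → (Fin k → Fin k → ℕ) → Carrier → Set (c ⊔ ℓ)
  IsEigenvalue M λ' = Σ _ (λ x → IsEigenvector M λ' x)

-- Counting the edges between C_i and C_j from both ends gives
-- |C_i| b_ij = |C_j| b_ji, i.e. Bᵀ D = D B for D = diag(|C_1|, …, |C_k|).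
-- Since every cell is nonempty, D is invertible, so x ↦ D x is a bijection
-- from the λ-eigenvectors of B onto those of Bᵀ, and ⟨D x, e⟩ = ⟨x, D e⟩.
module Submission where

open import Defs
open import Level using (Level)
open import Data.Nat using (ℕ; zero; suc; _<_; z≤n; s≤s)
import Data.Nat as ℕ
import Data.Nat.Properties as ℕ
open import Data.Fin using (Fin; zero; suc; _≟_)
open import Data.Bool using (Bool; true; false; _∧_; if_then_else_)
open import Data.Product using (Σ; _×_; _,_; proj₁; proj₂)
open import Data.Sum using (inj₁; inj₂)
open import Function using (_∘_)
open import Function.Bundles using (_⇔_; mk⇔)
open import Relation.Nullary using (¬_; yes; no)
open import Relation.Nullary.Decidable using (⌊_⌋; isYes≗does; dec-true)
open import Relation.Binary.PropositionalEquality as ≡ using (_≡_; refl; cong)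
open import Relation.Binary.Structures using (IsTotalOrder)
import Algebra.Properties.Semiring.Sum as SemiringSum
import Algebra.Properties.Semiring.Mult as SemiringMult
import Algebra.Properties.Ring as RingProperties
import Algebra.Properties.CommutativeSemigroup as CommutativeSemigroupProperties
import Relation.Binary.Reasoning.Setoid as SetoidReasoning

open SemiringSum ℕ.+-*-semiring using (sum; sum-cong-≗; ∑-comm; *-distribˡ-sum; *-distribʳ-sum)
open CommutativeSemigroupProperties ℕ.*-commutativeSemigroup using (x∙yz≈z∙yx)

fromBool : Bool → ℕ
fromBool b = if b then 1 else 0

fromBool-∧ : ∀ a b → fromBool (a ∧ b) ≡ fromBool a ℕ.* fromBool b
fromBool-∧ true  b = ≡.sym (ℕ.*-identityˡ (fromBool b))
fromBool-∧ false b = refl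

fromBool-≟-* : ∀ {k} (a b : Fin k) (f : Fin k → ℕ) →
               fromBool ⌊ a ≟ b ⌋ ℕ.* f a ≡ fromBool ⌊ a ≟ b ⌋ ℕ.* f b
fromBool-≟-* a b f with a ≟ b
... | yes refl = refl
... | no  _    = refl

countFin≡sum : ∀ n (p : Fin n → Bool) → countFin n p ≡ sum (fromBool ∘ p)
countFin≡sum zero    p = refl
countFin≡sum (suc n) p = cong (fromBool (p zero) ℕ.+_) (countFin≡sum n (p ∘ suc))

countFin-pos : ∀ n (p : Fin n → Bool) {v} → p v ≡ true → 0 < countFin n p
countFin-pos (suc n) p {zero}  pv≡true rewrite pv≡true = s≤s z≤n
countFin-pos (suc n) p {suc v} pv≡true =
  ℕ.<-≤-trans (countFin-pos n (p ∘ suc) pv≡true) (ℕ.m≤n+m _ (fromBool (p zero)))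

cellSize-pos : ∀ {n k} {cell : Fin n → Fin k} → IsPartition n k cell →
               ∀ i → 0 < cellSize cell i
cellSize-pos {n} {cell = cell} surjective i =
  let v , cell≡i = surjective i
  in countFin-pos n (λ w → ⌊ cell w ≟ i ⌋)
       (≡.trans (isYes≗does (cell v ≟ i)) (dec-true (cell v ≟ i) (cell≡i refl)))

module DoubleCounting {n k} (G : SimpleGraph n) (cell : Fin n → Fin k) where
  open SimpleGraph G
  open ≡.≡-Reasoning

  inCell : Fin k → Fin n → ℕ
  inCell i v = fromBool ⌊ cell v ≟ i ⌋

  neighbourIndicator : Fin n → Fin k → Fin n → ℕ
  neighbourIndicator v j w = fromBool (adj v w) ℕ.* inCell j w

  isEdgeBetween : Fin k → Fin k → Fin n → Fin n → ℕ
  isEdgeBetween i j v w = inCell i v ℕ.* neighbourIndicator v j w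

  edgesBetween : Fin k → Fin k → ℕ
  edgesBetween i j = sum λ v → sum λ w → isEdgeBetween i j v w

  isEdgeBetween-sym : ∀ i j v w → isEdgeBetween i j v w ≡ isEdgeBetween j i w v
  isEdgeBetween-sym i j v w =
    ≡.trans (x∙yz≈z∙yx (inCell i v) (fromBool (adj v w)) (inCell j w))
            (cong (λ a → inCell j w ℕ.* (fromBool a ℕ.* inCell i v)) (adj-sym v w))

  edgesBetween-sym : ∀ i j → edgesBetween i j ≡ edgesBetween j i
  edgesBetween-sym i j = ≡.trans (∑-comm (isEdgeBetween i j))
    (sum-cong-≗ λ w → sum-cong-≗ λ v → isEdgeBetween-sym i j v w)

  neighboursIn≡sum : ∀ v j → neighboursIn G cell v j ≡ sum (neighbourIndicator v j)
  neighboursIn≡sum v j = ≡.trans (countFin≡sum n _) (sum-cong-≗ λ w → fromBool-∧ (adj v w) _)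

  edgesBetween≡cellSize*divisor : ∀ {B} → IsEquitableWithDivisor G cell B →
                                  ∀ i j → edgesBetween i j ≡ cellSize cell i ℕ.* B i j
  edgesBetween≡cellSize*divisor {B} equitable i j = begin
    edgesBetween i j
      ≡⟨ sum-cong-≗ (λ v → ≡.sym (*-distribˡ-sum (inCell i v) (neighbourIndicator v j))) ⟩
    sum (λ v → inCell i v ℕ.* sum (neighbourIndicator v j))
      ≡⟨ sum-cong-≗ (λ v → cong (inCell i v ℕ.*_) (≡.sym (neighboursIn≡sum v j))) ⟩
    sum (λ v → inCell i v ℕ.* neighboursIn G cell v j)
      ≡⟨ sum-cong-≗ (λ v → cong (inCell i v ℕ.*_) (equitable v j)) ⟩
    sum (λ v → inCell i v ℕ.* B (cell v) j)
      ≡⟨ sum-cong-≗ (λ v → fromBool-≟-* (cell v) i (λ c → B c j)) ⟩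
    sum (λ v → inCell i v ℕ.* B i j)
      ≡⟨ ≡.sym (*-distribʳ-sum (B i j) (inCell i)) ⟩
    sum (inCell i) ℕ.* B i j
      ≡⟨ cong (ℕ._* B i j) (≡.sym (countFin≡sum n _)) ⟩
    cellSize cell i ℕ.* B i j ∎

cellSize*divisor-sym : ∀ {n k} (G : SimpleGraph n) {cell : Fin n → Fin k} {B} →
                       IsEquitableWithDivisor G cell B →
                       ∀ i j → cellSize cell i ℕ.* B i j ≡ cellSize cell j ℕ.* B j i
cellSize*divisor-sym G {cell} {B} equitable i j = begin
  cellSize cell i ℕ.* B i j ≡⟨ ≡.sym (edgesBetween≡cellSize*divisor equitable i j) ⟩
  edgesBetween i j          ≡⟨ edgesBetween-sym i j ⟩
  edgesBetween j i          ≡⟨ edgesBetween≡cellSize*divisor equitable j i ⟩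
  cellSize cell j ℕ.* B j i ∎
  where open DoubleCounting G cell
        open ≡.≡-Reasoning

module _ {c ℓ : Level} (R : RealField c ℓ) where
  open RealField R hiding (zero; refl)
  open RealField R using () renaming (refl to ≈-refl)
  open SemiringMult semiring using (×1-homo-*) renaming (_×_ to _×ᵣ_)
  open RingProperties ring using (-1*x≈-x; -‿involutive)
  open SetoidReasoning setoid
  open CommutativeSemigroupProperties *-commutativeSemigroup using (x∙yz≈y∙xz)
  private module ≤ = IsTotalOrder isTotalOrder

  Σℝ-cong : ∀ k {f g : Fin k → Carrier} → (∀ i → f i ≈ g i) → Σℝ R k f ≈ Σℝ R k g
  Σℝ-cong zero    f≈g = ≈-refl
  Σℝ-cong (suc k) f≈g = +-cong (f≈g zero) (Σℝ-cong k (f≈g ∘ suc))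

  Σℝ-zero : ∀ k {f : Fin k → Carrier} → (∀ i → f i ≈ 0#) → Σℝ R k f ≈ 0#
  Σℝ-zero zero    f≈0 = ≈-refl
  Σℝ-zero (suc k) f≈0 = trans (+-cong (f≈0 zero) (Σℝ-zero k (f≈0 ∘ suc))) (+-identityˡ 0#)

  *-distribˡ-Σℝ : ∀ k a (f : Fin k → Carrier) → a * Σℝ R k f ≈ Σℝ R k (λ i → a * f i)
  *-distribˡ-Σℝ zero    a f = zeroʳ a
  *-distribˡ-Σℝ (suc k) a f = trans (distribˡ a _ _) (+-congˡ (*-distribˡ-Σℝ k a (f ∘ suc)))

  dot≉0⇒nonzero : ∀ {k} (x y : Fin k → Carrier) → ¬ (dot R x y ≈ 0#) → NonzeroVec R x
  dot≉0⇒nonzero {k} x y dot≉0 x≈0 =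
    dot≉0 (Σℝ-zero k (λ i → trans (*-congʳ (x≈0 i)) (zeroˡ (y i))))

  ι≡×1# : ∀ m → ι R m ≡ m ×ᵣ 1#
  ι≡×1# zero    = refl
  ι≡×1# (suc m) = cong (1# +_) (ι≡×1# m)

  ι-homo-* : ∀ m n → ι R (m ℕ.* n) ≈ ι R m * ι R n
  ι-homo-* m n = begin
    ι R (m ℕ.* n)          ≡⟨ ι≡×1# (m ℕ.* n) ⟩
    (m ℕ.* n) ×ᵣ 1#        ≈⟨ ×1-homo-* m n ⟩
    (m ×ᵣ 1#) * (n ×ᵣ 1#)  ≡⟨ ≡.sym (≡.cong₂ _*_ (ι≡×1# m) (ι≡×1# n)) ⟩
    ι R m * ι R n          ∎

  -- if 1 ≤ 0 then 0 ≤ -1, hence 0 ≤ (-1)(-1) = 1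
  0≤1 : 0# ≤ 1#
  0≤1 with ≤.total 0# 1#
  ... | inj₁ 0≤1 = 0≤1
  ... | inj₂ 1≤0 = ≤.trans (*-nonneg 0≤-1 0≤-1) (≤.reflexive -1*-1≈1)
    where
    0≤-1 : 0# ≤ (- 1#)
    0≤-1 = ≤.trans (≤.reflexive (sym (-‿inverseʳ 1#)))
             (≤.trans (+-mono-≤ (- 1#) 1≤0) (≤.reflexive (+-identityˡ (- 1#))))
    -1*-1≈1 : - 1# * - 1# ≈ 1#
    -1*-1≈1 = trans (-1*x≈-x (- 1#)) (-‿involutive 1#)

  1≤1+ : ∀ {x} → 0# ≤ x → 1# ≤ (1# + x)
  1≤1+ {x} 0≤x = ≤.trans (≤.reflexive (sym (+-identityˡ 1#)))
                   (≤.trans (+-mono-≤ 1# 0≤x) (≤.reflexive (+-comm x 1#)))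

  ι-nonneg : ∀ m → 0# ≤ ι R m
  ι-nonneg zero    = ≤.refl
  ι-nonneg (suc m) = ≤.trans 0≤1 (1≤1+ (ι-nonneg m))

  ι≉0 : ∀ {m} → 0 < m → ¬ (ι R m ≈ 0#)
  ι≉0 {suc m} _ ι≈0 =
    nontrivial (≤.antisym 0≤1 (≤.trans (1≤1+ (ι-nonneg m)) (≤.reflexive ι≈0)))

  *-cancelˡ : ∀ {s t a b} → s * t ≈ 1# → s * a ≈ s * b → a ≈ b
  *-cancelˡ {s} {t} {a} {b} st≈1 sa≈sb = begin
    a             ≈⟨ sym (*-identityˡ a) ⟩
    1# * a        ≈⟨ *-congʳ (sym ts≈1) ⟩
    (t * s) * a   ≈⟨ *-assoc t s a ⟩
    t * (s * a)   ≈⟨ *-congˡ sa≈sb ⟩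
    t * (s * b)   ≈⟨ sym (*-assoc t s b) ⟩
    (t * s) * b   ≈⟨ *-congʳ ts≈1 ⟩
    1# * b        ≈⟨ *-identityˡ b ⟩
    b             ∎
    where ts≈1 = trans (*-comm t s) st≈1

  *-inverseʳ-cancel : ∀ {s t a} → s * t ≈ 1# → s * (t * a) ≈ a
  *-inverseʳ-cancel {s} {t} {a} st≈1 =
    trans (sym (*-assoc s t a)) (trans (*-congʳ st≈1) (*-identityˡ a))

  matVec-cong : ∀ {k} (M : Fin k → Fin k → ℕ) {x y : Fin k → Carrier} →
                (∀ j → x j ≈ y j) → ∀ i → matVec R M x i ≈ matVec R M y i
  matVec-cong {k} M x≈y i = Σℝ-cong k (λ j → *-congˡ (x≈y j))

  NonOrthogonalEigenvector : ∀ {k} → (Fin k → Fin k → ℕ) → Carrier →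
                             (Fin k → Carrier) → (Fin k → Carrier) → Set ℓ
  NonOrthogonalEigenvector M λ' u x = IsEigenvector R M λ' x × ¬ (dot R x u ≈ 0#)

  module DiagonalIntertwining {k} (B : Fin k → Fin k → ℕ) (s : Fin k → Carrier)
    (balanced : ∀ i j → ι R (B j i) * s j ≈ s i * ι R (B i j))
    (s≉0 : ∀ i → ¬ (s i ≈ 0#)) where

    scale : (Fin k → Carrier) → Fin k → Carrier
    scale x i = s i * x i

    matVec-transpose-scale : ∀ x i →
                             matVec R (transpose R B) (scale x) i ≈ s i * matVec R B x i
    matVec-transpose-scale x i = begin
      Σℝ R k (λ j → ι R (B j i) * (s j * x j))   ≈⟨ Σℝ-cong k (λ j → begin
          ι R (B j i) * (s j * x j)                ≈⟨ sym (*-assoc _ _ _) ⟩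
          (ι R (B j i) * s j) * x j                ≈⟨ *-congʳ (balanced i j) ⟩
          (s i * ι R (B i j)) * x j                ≈⟨ *-assoc _ _ _ ⟩
          s i * (ι R (B i j) * x j)                ∎) ⟩
      Σℝ R k (λ j → s i * (ι R (B i j) * x j))   ≈⟨ sym (*-distribˡ-Σℝ k (s i) _) ⟩
      s i * matVec R B x i                        ∎

    dot-scale-ones : ∀ x → dot R (scale x) (λ _ → 1#) ≈ dot R x s
    dot-scale-ones x = Σℝ-cong k (λ i → trans (*-identityʳ _) (*-comm (s i) (x i)))

    scale-eigen : ∀ {λ' x} → (∀ i → matVec R B x i ≈ λ' * x i) →
                  ∀ i → matVec R (transpose R B) (scale x) i ≈ λ' * scale x i
    scale-eigen {λ'} {x} eig i = begin
      matVec R (transpose R B) (scale x) i  ≈⟨ matVec-transpose-scale x i ⟩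
      s i * matVec R B x i                 ≈⟨ *-congˡ (eig i) ⟩
      s i * (λ' * x i)                     ≈⟨ x∙yz≈y∙xz (s i) λ' (x i) ⟩
      λ' * scale x i                       ∎

    unscale-eigen : ∀ {λ'} {t x y : Fin k → Carrier} →
                    (∀ i → s i * t i ≈ 1#) → (∀ i → scale x i ≈ y i) →
                    (∀ i → matVec R (transpose R B) y i ≈ λ' * y i) →
                    ∀ i → matVec R B x i ≈ λ' * x i
    unscale-eigen {λ'} {t} {x} {y} st≈1 sx≈y eig i = *-cancelˡ (st≈1 i) (begin
      s i * matVec R B x i                  ≈⟨ sym (matVec-transpose-scale x i) ⟩
      matVec R (transpose R B) (scale x) i  ≈⟨ matVec-cong (transpose R B) sx≈y i ⟩
      matVec R (transpose R B) y i          ≈⟨ eig i ⟩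
      λ' * y i                             ≈⟨ *-congˡ (sym (sx≈y i)) ⟩
      λ' * (s i * x i)                     ≈⟨ x∙yz≈y∙xz λ' (s i) (x i) ⟩
      s i * (λ' * x i)                     ∎)

    s⁻¹ : Fin k → Carrier
    s⁻¹ i = proj₁ (inverse (s i) (s≉0 i))

    s*s⁻¹≈1 : ∀ i → s i * s⁻¹ i ≈ 1#
    s*s⁻¹≈1 i = proj₂ (inverse (s i) (s≉0 i))

    eigenvectors-⇔ : ∀ λ' → Σ _ (NonOrthogonalEigenvector B λ' s) ⇔
                            Σ _ (NonOrthogonalEigenvector (transpose R B) λ' (λ _ → 1#))
    eigenvectors-⇔ λ' = mk⇔ forward backward
      where
      forward : Σ _ (NonOrthogonalEigenvector B λ' s) →
                Σ _ (NonOrthogonalEigenvector (transpose R B) λ' (λ _ → 1#))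
      forward (x , (_ , eig) , ⟨x,s⟩≉0) =
        scale x , (dot≉0⇒nonzero _ _ ⟨sx,1⟩≉0 , scale-eigen eig) , ⟨sx,1⟩≉0
        where
        ⟨sx,1⟩≉0 : ¬ (dot R (scale x) (λ _ → 1#) ≈ 0#)
        ⟨sx,1⟩≉0 = ⟨x,s⟩≉0 ∘ trans (sym (dot-scale-ones x))

      backward : Σ _ (NonOrthogonalEigenvector (transpose R B) λ' (λ _ → 1#)) →
                 Σ _ (NonOrthogonalEigenvector B λ' s)
      backward (y , (_ , eig) , ⟨y,1⟩≉0) =
        x , (dot≉0⇒nonzero _ _ ⟨x,s⟩≉0 , unscale-eigen s*s⁻¹≈1 sx≈y eig) , ⟨x,s⟩≉0
        where
        x : Fin k → Carrier
        x i = s⁻¹ i * y i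
        sx≈y : ∀ i → scale x i ≈ y i
        sx≈y i = *-inverseʳ-cancel (s*s⁻¹≈1 i)
        ⟨x,s⟩≉0 : ¬ (dot R x s ≈ 0#)
        ⟨x,s⟩≉0 = ⟨y,1⟩≉0 ∘ trans (sym (Σℝ-cong k (λ i → *-congʳ (sx≈y i))))
                          ∘ trans (dot-scale-ones x)

  balanced-cellSizes : ∀ {n k} (G : SimpleGraph n) {cell : Fin n → Fin k} {B} →
    IsEquitableWithDivisor G cell B →
    ∀ i j → ι R (B j i) * ι R (cellSize cell j) ≈ ι R (cellSize cell i) * ι R (B i j)
  balanced-cellSizes G {cell} {B} equitable i j = begin
    ι R (B j i) * ι R (cellSize cell j)   ≈⟨ *-comm _ _ ⟩
    ι R (cellSize cell j) * ι R (B j i)   ≈⟨ sym (ι-homo-* (cellSize cell j) (B j i)) ⟩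
    ι R (cellSize cell j ℕ.* B j i)       ≡⟨ cong (ι R) (cellSize*divisor-sym G equitable j i) ⟩
    ι R (cellSize cell i ℕ.* B i j)       ≈⟨ ι-homo-* (cellSize cell i) (B i j) ⟩
    ι R (cellSize cell i) * ι R (B i j)   ∎

corollary2p3 : {c ℓ : Level} (R : RealField c ℓ) {n k : ℕ}
    (G : SimpleGraph n) (cell : Fin n → Fin k) (B : Fin k → Fin k → ℕ) →
    IsPartition n k cell →
    IsEquitableWithDivisor G cell B →
    (λ' : RealField.Carrier R) → IsEigenvalue R B λ' →
    (Σ (Fin k → RealField.Carrier R) (λ x → IsEigenvector R B λ' x ×
        ¬ (RealField._≈_ R (dot R x (λ i → ι R (cellSize cell i))) (RealField.0# R))))
    ⇔
    (Σ (Fin k → RealField.Carrier R) (λ y → IsEigenvector R (transpose R B) λ' y ×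
        ¬ (RealField._≈_ R (dot R y (λ i → RealField.1# R)) (RealField.0# R))))
corollary2p3 R G cell B partition equitable λ' _ =
  DiagonalIntertwining.eigenvectors-⇔ R B (ι R ∘ cellSize cell)
    (balanced-cellSizes R G {B = B} equitable)
    (λ i → ι≉0 R (cellSize-pos partition i))
    λ'
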